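{- Let $G$ be a finite simple graph and $t\ge 1$ an integer. Then $\partial\Gamma(G)\ge t$ if and only if $G$ contains an induced subgraph isomorphic to a minimal pG-$t$-atom.
   Context: A proper $k$-coloring of $G$ is a surjective map $c:V(G)\to\{1,\dots,k\}$ with $c(u)\ne c(v)$ for every edge $uv$. In a proper coloring, a vertex of color $i$ is a Grundy vertex if for every $j<i$ it has a neighbor of color $j$. A partial Grundy $k$-coloring is a proper $k$-coloring in which every color class contains at least one Grundy vertex; the partial Grundy number $\partial\Gamma(G)$ is the largest $k$ such that $G$ has a partial Grundy $k$-coloring. A pG-$t$-atom is a graph $A$ whose vertex set can be partitioned into $t$ sets $D_1,\dots,D_t$, where each $D_i$ contains a special vertex $c_i$, such that: each $D_i$ is an independent set with $|D_i|\le t-i+1$, and for every $i\in\{2,\dots,t\}$ the vertex $c_i$ has a neighbor in each of $D_1,\dots,D_{i-1}$. A pG-$t$-atom is minimal if no pG-$t$-atom is a proper induced subgraph of it. -}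

module Defs where

open import Data.Nat using (ℕ; zero; suc; _≤_; _<_; _∸_)
open import Data.Fin using (Fin; toℕ; _≟_)
open import Data.Fin as Fin using ()
open import Data.Bool using (Bool; true; false)
open import Data.List using (List; length; filter)
open import Data.List using () renaming (allFin to listAllFin)
open import Data.Product using (Σ; ∃; ∃-syntax; _×_; _,_)
open import Relation.Binary.PropositionalEquality using (_≡_; _≢_)
open import Relation.Nullary using (¬_)
open import Function.Definitions using (Injective; Surjective)

record Graph : Set where
  field
    n     : ℕ
    adj   : Fin n → Fin n → Bool
    sym   : ∀ u v → adj u v ≡ adj v u
    irrfl : ∀ v → adj v v ≡ false
open Graph public

Adj : (G : Graph) → Fin (n G) → Fin (n G) → Set
Adj G u v = adj G u v ≡ true

-- Colours 1..k are represented by Fin k (colour i+1 ↦ i).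
Proper : (G : Graph) (k : ℕ) → (Fin (n G) → Fin k) → Set
Proper G k c = ∀ u v → Adj G u v → c u ≢ c v

GrundyVertex : (G : Graph) (k : ℕ) → (Fin (n G) → Fin k) → Fin (n G) → Set
GrundyVertex G k c v = ∀ (j : Fin k) → toℕ j < toℕ (c v) → ∃[ u ] (Adj G v u × c u ≡ j)

PartialGrundyColoring : (G : Graph) (k : ℕ) → (Fin (n G) → Fin k) → Set
PartialGrundyColoring G k c =
  Proper G k c × Surjective _≡_ _≡_ c ×
  (∀ (i : Fin k) → ∃[ v ] (c v ≡ i × GrundyVertex G k c v))

HasPartialGrundyColoring : Graph → ℕ → Set
HasPartialGrundyColoring G k = ∃[ c ] PartialGrundyColoring G k c

IsPartialGrundyNumber : Graph → ℕ → Set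
IsPartialGrundyNumber G m =
  HasPartialGrundyColoring G m × (∀ k → HasPartialGrundyColoring G k → k ≤ m)

InducedEmbedding : (H G : Graph) → (Fin (n H) → Fin (n G)) → Set
InducedEmbedding H G f = Injective _≡_ _≡_ f × (∀ u v → adj H u v ≡ adj G (f u) (f v))

IsInducedSubgraph : Graph → Graph → Set
IsInducedSubgraph H G = ∃[ f ] InducedEmbedding H G f

IsProperInducedSubgraph : Graph → Graph → Set
IsProperInducedSubgraph H G = IsInducedSubgraph H G × n H < n G

classSize : {m t : ℕ} → (Fin m → Fin t) → Fin t → ℕ
classSize {m} d i = length (filter (λ v → d v ≟ i) (listAllFin m))

-- pG-t-atom. Classes D_1..D_t are indexed by Fin t (D_{i+1} ↦ i),
-- d assigns each vertex its class, cv i is the special vertex c_i ∈ D_i.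
PGAtom : Graph → ℕ → Set
PGAtom A t =
  Σ (Fin (n A) → Fin t) λ d →
  Σ (Fin t → Fin (n A)) λ cv →
    (∀ i → d (cv i) ≡ i) ×
    (∀ u v → Adj A u v → d u ≢ d v) ×
    (∀ i → classSize d i ≤ t ∸ toℕ i) ×
    (∀ i j → toℕ j < toℕ i → ∃[ u ] (Adj A (cv i) u × d u ≡ j))

MinimalPGAtom : Graph → ℕ → Set
MinimalPGAtom A t = PGAtom A t × ¬ (∃[ B ] (PGAtom B t × IsProperInducedSubgraph B A))

-- Forward: in a partial Grundy m-colouring with t ≤ m, take for every colour a < t a Grundy
-- vertex of colour a together with one neighbour of each colour b < a.  These vertices
-- induce a pG-t-atom whose class D_b consists of the chosen neighbours of colour b of the
-- Grundy vertices of colours a ≥ b, hence has at most t − b elements.  Since being an atom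
-- is decidable, descending along proper induced sub-atoms ends in a minimal one.
-- Backward: the classes of an induced atom form a partial colouring of G in which every
-- colour below t already has a Grundy vertex; colouring the remaining vertices greedily,
-- each with the least colour missing from its coloured neighbourhood, keeps this property
-- and yields a partial Grundy colouring of G with at least t colours.
module Submission where

open import Defs
open import Data.Nat using (ℕ; _≤_)
open import Data.Product using (∃-syntax; _×_)
open import Function.Bundles using (_⇔_)

open import Level using (0ℓ)
open import Data.Bool using (true)
import Data.Bool.Properties as Bool
open import Data.Empty using (⊥-elim)
open import Data.Fin using (Fin; zero; suc; toℕ; fromℕ; fromℕ<; inject≤; _≟_)
open import Data.Fin.Properties
  using (any?; all?; ¬Fin0; suc-injective; toℕ-injective; toℕ<n; toℕ-fromℕ; toℕ-fromℕ<;
         toℕ-inject; toℕ-inject≤; inject≤-injective; ¬∀⟶∃¬-smallest)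
open import Data.List using (List; []; _∷_; _++_; length; filter; map; allFin)
open import Data.List.Properties using (length-map; length-tabulate; length-++-sucʳ; filter-≐)
open import Data.List.Membership.Propositional using (_∈_)
open import Data.List.Membership.Propositional.Properties
  using (∈-allFin; ∈-map⁺; ∈-map⁻; ∈-filter⁻; ∈-∃++; ∈-++⁻; ∈-++⁺ˡ; ∈-++⁺ʳ)
open import Data.List.Relation.Binary.Subset.Propositional using () renaming (_⊆_ to _⊆ₗ_)
open import Data.List.Relation.Unary.Any using (here; there)
import Data.List.Relation.Unary.All as All
open import Data.List.Relation.Unary.AllPairs using (_∷_)
open import Data.List.Relation.Unary.Unique.Propositional using (Unique)
import Data.List.Relation.Unary.Unique.Propositional.Properties as Unique
import Data.Nat as ℕ
open import Data.Nat using (zero; suc; _<_; _∸_; _+_; z≤n; s≤s; _<?_)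
open import Data.Nat.Properties
  using (≤-refl; ≤-trans; <-trans; <-≤-trans; ≤-pred; <⇒≤; n≤1+n; <-irrefl; m≤n⇒m<n∨m≡n;
         m≤o∸n⇒m+n≤o; ∸-monoˡ-<; m∸n+n≡m; anyUpTo?)
open import Data.Nat.Induction using (<-wellFounded)
open import Data.Product using (∃; _,_; proj₁; proj₂)
import Data.Product as Product
open import Data.Sum using (_⊎_; inj₁; inj₂)
import Data.Vec.Functional as Vector
open import Data.Vec.Functional.Properties using (updateAt-updates; updateAt-minimal)
open import Function using (_∘_; const)
open import Function.Bundles using (mk⇔)
open import Function.Definitions using (Injective)
open import Induction.WellFounded using (Acc; acc)
open import Relation.Binary.Definitions using (_Respects_)
open import Relation.Binary.PropositionalEquality as ≡
  using (_≡_; _≢_; _≗_; refl; cong; cong₂; subst; subst₂)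
open import Relation.Nullary using (¬_; Dec; yes; no; contradiction)
open import Relation.Nullary.Decidable using (map′; ¬?; _×-dec_; _⊎-dec_; _→-dec_)
open import Relation.Unary using (Pred; Decidable; _⊆_)

anyFunction? : ∀ a b {P : Pred (Fin a → Fin b) 0ℓ} → P Respects _≗_ → Decidable P → Dec (∃ P)
anyFunction? zero b resp P? = map′ (empty ,_) (λ (f , p) → resp (λ ()) p) (P? empty)
  where
  empty : Fin 0 → Fin b
  empty ()
anyFunction? (suc a) b resp P? =
  map′ (λ (x , f , p) → x Vector.∷ f , p)
       (λ (f , p) → Vector.head f , Vector.tail f , resp (λ { zero → refl ; (suc i) → refl }) p)
       (any? λ x → anyFunction? a b (λ f≗g → resp (λ { zero → refl ; (suc i) → f≗g i }))
                                    (λ f → P? (x Vector.∷ f)))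

injective? : ∀ {a b} (f : Fin a → Fin b) → Dec (Injective _≡_ _≡_ f)
injective? f =
  map′ (λ inj {x} {y} → inj x y) (λ inj x y → inj)
       (all? λ x → all? λ y → (f x ≟ f y) →-dec (x ≟ y))

∃¬-smallest≤ : ∀ {P : Pred ℕ 0ℓ} → Decidable P → ∀ K → ¬ P K →
               ∃ λ s → s ≤ K × ¬ P s × (∀ j → j < s → P j)
∃¬-smallest≤ {P} P? K ¬PK
  with ¬∀⟶∃¬-smallest (suc K) (P ∘ toℕ) (P? ∘ toℕ)
                      (λ ∀P → ¬PK (subst P (toℕ-fromℕ K) (∀P (fromℕ K))))
... | i , ¬Pi , below = toℕ i , ≤-pred (toℕ<n i) , ¬Pi , below′
  where
  below′ : ∀ j → j < toℕ i → P j
  below′ j j<i = subst P (≡.trans (toℕ-inject (fromℕ< j<i)) (toℕ-fromℕ< j<i)) (below (fromℕ< j<i))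

Unique-⊆⇒length≤ : ∀ {A : Set} {xs ys : List A} → Unique xs → xs ⊆ₗ ys → length xs ≤ length ys
Unique-⊆⇒length≤ {xs = []} _ _ = z≤n
Unique-⊆⇒length≤ {xs = x ∷ xs} (x∉xs ∷ unique) xs⊆ys with ∈-∃++ (xs⊆ys (here refl))
... | ys₁ , ys₂ , refl =
  subst (suc (length xs) ≤_) (≡.sym (length-++-sucʳ ys₁ x ys₂))
        (s≤s (Unique-⊆⇒length≤ unique xs⊆ys₁++ys₂))
  where
  xs⊆ys₁++ys₂ : xs ⊆ₗ ys₁ ++ ys₂
  xs⊆ys₁++ys₂ y∈xs with ∈-++⁻ ys₁ (xs⊆ys (there y∈xs))
  ... | inj₁ y∈ys₁         = ∈-++⁺ˡ y∈ys₁
  ... | inj₂ (here y≡x)    = ⊥-elim (All.lookup x∉xs y∈xs (≡.sym y≡x))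
  ... | inj₂ (there y∈ys₂) = ∈-++⁺ʳ ys₁ y∈ys₂

record Enumeration {N : ℕ} (P : Pred (Fin N) 0ℓ) : Set where
  field
    size      : ℕ
    element   : Fin size → Fin N
    injective : Injective _≡_ _≡_ element
    sound     : ∀ u → P (element u)
    complete  : ∀ {v} → P v → ∃ λ u → element u ≡ v

enumerate : ∀ {N} {P : Pred (Fin N) 0ℓ} → Decidable P → Enumeration P
enumerate {zero} P? = record
  { size = 0 ; element = λ () ; injective = λ {u} → ⊥-elim (¬Fin0 u)
  ; sound = λ () ; complete = λ {v} → ⊥-elim (¬Fin0 v) }
enumerate {suc N} P? with enumerate (P? ∘ suc) | P? zero
... | E | yes P0 = record
  { size = suc size ; element = zero Vector.∷ (suc ∘ element) ; injective = injective′
  ; sound = λ { zero → P0 ; (suc u) → sound u }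
  ; complete = λ { {zero} _ → zero , refl
               ; {suc v} Pv → Product.map suc (cong suc) (complete Pv) } }
  where
  open Enumeration E
  injective′ : Injective _≡_ _≡_ (zero Vector.∷ (suc ∘ element))
  injective′ {zero}  {zero}  _  = refl
  injective′ {suc u} {suc w} eq = cong suc (injective (suc-injective eq))
... | E | no ¬P0 = record
  { size = size ; element = suc ∘ element ; injective = injective ∘ suc-injective
  ; sound = sound
  ; complete = λ { {zero} P0 → contradiction P0 ¬P0
               ; {suc v} Pv → Product.map₂ (cong suc) (complete Pv) } }
  where open Enumeration E

Adj-sym : (G : Graph) {u v : Fin (n G)} → Adj G u v → Adj G v u
Adj-sym G {u} {v} uv = ≡.trans (sym G v u) uv

Adj-irrefl : (G : Graph) {v : Fin (n G)} → ¬ Adj G v v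
Adj-irrefl G {v} vv with ≡.trans (≡.sym vv) (irrfl G v)
... | ()

induced : (G : Graph) {k : ℕ} → (Fin k → Fin (n G)) → Graph
induced G {k} f = record
  { n = k ; adj = λ u v → adj G (f u) (f v)
  ; sym = λ u v → sym G (f u) (f v) ; irrfl = λ v → irrfl G (f v) }

induced-isInduced : (G : Graph) {k : ℕ} {f : Fin k → Fin (n G)} →
                    Injective _≡_ _≡_ f → IsInducedSubgraph (induced G f) G
induced-isInduced G {f = f} f-inj = f , f-inj , λ _ _ → refl

IsInducedSubgraph-trans : ∀ {A B C} → IsInducedSubgraph A B → IsInducedSubgraph B C →
                          IsInducedSubgraph A C
IsInducedSubgraph-trans (f , f-inj , f-adj) (g , g-inj , g-adj) =
  g ∘ f , (λ eq → f-inj (g-inj eq)) , λ u v → ≡.trans (f-adj u v) (g-adj (f u) (f v))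

AtomStructure : (A : Graph) (t : ℕ) → (Fin (n A) → Fin t) → (Fin t → Fin (n A)) → Set
AtomStructure A t d cv =
  (∀ i → d (cv i) ≡ i) ×
  (∀ u v → Adj A u v → d u ≢ d v) ×
  (∀ i → classSize d i ≤ t ∸ toℕ i) ×
  (∀ i j → toℕ j < toℕ i → ∃[ u ] (Adj A (cv i) u × d u ≡ j))

classSize-cong : ∀ {k t} {d d′ : Fin k → Fin t} → d ≗ d′ → ∀ i → classSize d i ≡ classSize d′ i
classSize-cong {k} {d = d} {d′} d≗d′ i =
  cong length (filter-≐ (λ v → d v ≟ i) (λ v → d′ v ≟ i)
                        ((λ {v} → ≡.trans (≡.sym (d≗d′ v))) , (λ {v} → ≡.trans (d≗d′ v)))
                        (allFin k))

AtomStructure-cong : ∀ {A t} {d d′ : Fin (n A) → Fin t} {cv cv′ : Fin t → Fin (n A)} →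
                     d ≗ d′ → cv ≗ cv′ → AtomStructure A t d cv → AtomStructure A t d′ cv′
AtomStructure-cong {A} {t} {d} {d′} {cv} {cv′} d≗d′ cv≗cv′ (dcv , proper , small , reach) =
  (λ i → ≡.trans (≡.sym (d≗d′ (cv′ i))) (≡.trans (cong d (≡.sym (cv≗cv′ i))) (dcv i))) ,
  (λ u v uv eq → proper u v uv (≡.trans (d≗d′ u) (≡.trans eq (≡.sym (d≗d′ v))))) ,
  (λ i → subst (_≤ t ∸ toℕ i) (classSize-cong d≗d′ i) (small i)) ,
  reach′
  where
  reach′ : ∀ i j → toℕ j < toℕ i → ∃[ u ] (Adj A (cv′ i) u × d′ u ≡ j)
  reach′ i j j<i with reach i j j<i
  ... | u , cv-u , du≡j =
    u , subst (λ w → Adj A w u) (cv≗cv′ i) cv-u , ≡.trans (≡.sym (d≗d′ u)) du≡j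

PGAtom-induced : ∀ {t} (B A : Graph) {f : Fin (n B) → Fin (n A)} →
                 (∀ u v → adj B u v ≡ adj A (f u) (f v)) → PGAtom B t → PGAtom (induced A f) t
PGAtom-induced B A {f} f-adj (d , cv , dcv , proper , small , reach) =
  d , cv , dcv , (λ u v uv → proper u v (≡.trans (f-adj u v) uv)) , small , reach′
  where
  reach′ : ∀ i j → toℕ j < toℕ i → ∃[ u ] (Adj (induced A f) (cv i) u × d u ≡ j)
  reach′ i j j<i with reach i j j<i
  ... | u , cv-u , du≡j = u , ≡.trans (≡.sym (f-adj (cv i) u)) cv-u , du≡j

atomStructure? : (A : Graph) (t : ℕ) (d : Fin (n A) → Fin t) (cv : Fin t → Fin (n A)) →
                 Dec (AtomStructure A t d cv)
atomStructure? A t d cv =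
  all? (λ i → d (cv i) ≟ i) ×-dec
  all? (λ u → all? λ v → (adj A u v Bool.≟ true) →-dec ¬? (d u ≟ d v)) ×-dec
  all? (λ i → classSize d i ℕ.≤? t ∸ toℕ i) ×-dec
  all? (λ i → all? λ j → (toℕ j <? toℕ i) →-dec
                          any? λ u → (adj A (cv i) u Bool.≟ true) ×-dec (d u ≟ j))

pgAtom? : (A : Graph) (t : ℕ) → Dec (PGAtom A t)
pgAtom? A t =
  anyFunction? (n A) t (λ d≗d′ (cv , s) → cv , AtomStructure-cong {A} d≗d′ (λ _ → refl) s)
    λ d → anyFunction? t (n A) (AtomStructure-cong {A} (λ _ → refl)) (atomStructure? A t d)

-- A decidable form of ∃ B (PGAtom B t × IsProperInducedSubgraph B A): such a B is
-- isomorphic to the subgraph induced by its embedding.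
HasProperSubAtom : Graph → ℕ → Set
HasProperSubAtom A t =
  ∃ λ k → k < n A × ∃ λ (f : Fin k → Fin (n A)) → Injective _≡_ _≡_ f × PGAtom (induced A f) t

hasProperSubAtom? : (A : Graph) (t : ℕ) → Dec (HasProperSubAtom A t)
hasProperSubAtom? A t =
  anyUpTo? (λ k → anyFunction? k (n A) resp λ f → injective? f ×-dec pgAtom? (induced A f) t) (n A)
  where
  resp : ∀ {k} {f g : Fin k → Fin (n A)} → f ≗ g →
         Injective _≡_ _≡_ f × PGAtom (induced A f) t → Injective _≡_ _≡_ g × PGAtom (induced A g) t
  resp {f = f} {g} f≗g (f-inj , atom) =
    (λ {x} {y} eq → f-inj (≡.trans (f≗g x) (≡.trans eq (≡.sym (f≗g y))))) ,
    PGAtom-induced (induced A f) A (λ u v → cong₂ (adj A) (f≗g u) (f≗g v)) atom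

hasProperSubAtom-complete : ∀ {A t} → ∃[ B ] (PGAtom B t × IsProperInducedSubgraph B A) →
                            HasProperSubAtom A t
hasProperSubAtom-complete {A} (B , atom , (f , f-inj , f-adj) , nB<nA) =
  n B , nB<nA , f , f-inj , PGAtom-induced B A f-adj atom

minimalAtom-below : ∀ {t} (G A : Graph) → PGAtom A t → IsInducedSubgraph A G →
                    ∃[ A′ ] (MinimalPGAtom A′ t × IsInducedSubgraph A′ G)
minimalAtom-below {t} G A = descend A (<-wellFounded (n A))
  where
  descend : ∀ A → Acc _<_ (n A) → PGAtom A t → IsInducedSubgraph A G →
            ∃[ A′ ] (MinimalPGAtom A′ t × IsInducedSubgraph A′ G)
  descend A (acc smaller) atom A⊆G with hasProperSubAtom? A t
  ... | no minimal = A , (atom , minimal ∘ hasProperSubAtom-complete {A}) , A⊆G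
  ... | yes (k , k<nA , f , f-inj , atom′) =
    descend (induced A f) (smaller k<nA) atom′
      (IsInducedSubgraph-trans {induced A f} {A} {G} (induced-isInduced A f-inj) A⊆G)

module FromPartialGrundy (G : Graph) {t m : ℕ} (t≤m : t ≤ m)
                         (c : Fin (n G) → Fin m) (pgc : PartialGrundyColoring G m c) where

  ι : Fin t → Fin m
  ι a = inject≤ a t≤m

  ι-injective : Injective _≡_ _≡_ ι
  ι-injective {a} {b} = inject≤-injective t≤m t≤m a b

  grundyVertex : Fin t → Fin (n G)
  grundyVertex a = proj₁ (proj₂ (proj₂ pgc) (ι a))

  c-grundyVertex : ∀ a → c (grundyVertex a) ≡ ι a
  c-grundyVertex a = proj₁ (proj₂ (proj₂ (proj₂ pgc) (ι a)))

  grundyVertex-isGrundy : ∀ a → GrundyVertex G m c (grundyVertex a)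
  grundyVertex-isGrundy a = proj₂ (proj₂ (proj₂ (proj₂ pgc) (ι a)))

  ι-below-grundyVertex : ∀ a b → toℕ b < toℕ a → toℕ (ι b) < toℕ (c (grundyVertex a))
  ι-below-grundyVertex a b b<a
    rewrite c-grundyVertex a | toℕ-inject≤ a t≤m | toℕ-inject≤ b t≤m = b<a

  neighbour : Fin t → Fin t → Fin (n G)
  neighbour a b with toℕ b <? toℕ a
  ... | yes b<a = proj₁ (grundyVertex-isGrundy a (ι b) (ι-below-grundyVertex a b b<a))
  ... | no _    = grundyVertex a

  neighbour-adjacent : ∀ a b → toℕ b < toℕ a →
                       Adj G (grundyVertex a) (neighbour a b) × c (neighbour a b) ≡ ι b
  neighbour-adjacent a b b<a with toℕ b <? toℕ a
  ... | yes b<a′ = proj₂ (grundyVertex-isGrundy a (ι b) (ι-below-grundyVertex a b b<a′))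
  ... | no b≮a   = contradiction b<a b≮a

  neighbour-grundyVertex : ∀ a b → ¬ toℕ b < toℕ a → neighbour a b ≡ grundyVertex a
  neighbour-grundyVertex a b b≮a with toℕ b <? toℕ a
  ... | yes b<a = contradiction b<a b≮a
  ... | no _    = refl

  neighbour-diagonal : ∀ a → neighbour a a ≡ grundyVertex a
  neighbour-diagonal a = neighbour-grundyVertex a a (<-irrefl refl)

  Candidate : Fin (n G) → Set
  Candidate v = ∃ λ x → c v ≡ ι x × ∃ λ a → toℕ x ≤ toℕ a × v ≡ neighbour a x

  neighbour-candidate : ∀ a b → Candidate (neighbour a b)
  neighbour-candidate a b = by-cases (toℕ b <? toℕ a)
    where
    by-cases : Dec (toℕ b < toℕ a) → Candidate (neighbour a b)
    by-cases (yes b<a) = b , proj₂ (neighbour-adjacent a b b<a) , a , <⇒≤ b<a , refl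
    by-cases (no b≮a)  =
      a , ≡.trans (cong c (neighbour-grundyVertex a b b≮a)) (c-grundyVertex a) ,
      a , ≤-refl , ≡.trans (neighbour-grundyVertex a b b≮a) (≡.sym (neighbour-diagonal a))

  Chosen : Pred (Fin (n G)) 0ℓ
  Chosen v = ∃ λ a → ∃ λ b → neighbour a b ≡ v

  open Enumeration (enumerate {P = Chosen} (λ v → any? λ a → any? λ b → neighbour a b ≟ v))

  atom : Graph
  atom = induced G element

  vertex : Fin t → Fin t → Fin size
  vertex a b = proj₁ (complete (a , b , refl))

  element-vertex : ∀ a b → element (vertex a b) ≡ neighbour a b
  element-vertex a b = proj₂ (complete (a , b , refl))

  element-candidate : ∀ u → Candidate (element u)
  element-candidate u with sound u
  ... | a , b , w≡eu = subst Candidate w≡eu (neighbour-candidate a b)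

  d : Fin size → Fin t
  d u = proj₁ (element-candidate u)

  c-element : ∀ u → c (element u) ≡ ι (d u)
  c-element u = proj₁ (proj₂ (element-candidate u))

  d-unique : ∀ {u x} → c (element u) ≡ ι x → d u ≡ x
  d-unique {u} cu≡ιx = ι-injective (≡.trans (≡.sym (c-element u)) cu≡ιx)

  cv : Fin t → Fin size
  cv i = vertex i i

  element-cv : ∀ i → element (cv i) ≡ grundyVertex i
  element-cv i = ≡.trans (element-vertex i i) (neighbour-diagonal i)

  d-cv : ∀ i → d (cv i) ≡ i
  d-cv i = d-unique (≡.trans (cong c (element-cv i)) (c-grundyVertex i))

  d-proper : ∀ u v → Adj atom u v → d u ≢ d v
  d-proper u v uv du≡dv =
    proj₁ pgc (element u) (element v) uv
      (≡.trans (c-element u) (≡.trans (cong ι du≡dv) (≡.sym (c-element v))))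

  cv-reaches : ∀ i j → toℕ j < toℕ i → ∃[ u ] (Adj atom (cv i) u × d u ≡ j)
  cv-reaches i j j<i =
    vertex i j ,
    subst₂ (Adj G) (≡.sym (element-cv i)) (≡.sym (element-vertex i j))
           (proj₁ (neighbour-adjacent i j j<i)) ,
    d-unique (≡.trans (cong c (element-vertex i j)) (proj₂ (neighbour-adjacent i j j<i)))

  above : (i : Fin t) → Fin (t ∸ toℕ i) → Fin t
  above i p = fromℕ< (m≤o∸n⇒m+n≤o (suc (toℕ p)) (<⇒≤ (toℕ<n i)) (toℕ<n p))

  above-surjective : ∀ i a → toℕ i ≤ toℕ a → ∃ λ p → above i p ≡ a
  above-surjective i a i≤a = p , toℕ-injective (≡.trans (toℕ-fromℕ< _) p+i≡a)
    where
    p : Fin (t ∸ toℕ i)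
    p = fromℕ< (∸-monoˡ-< (toℕ<n a) i≤a)
    p+i≡a : toℕ p + toℕ i ≡ toℕ a
    p+i≡a = ≡.trans (cong (_+ toℕ i) (toℕ-fromℕ< _)) (m∸n+n≡m i≤a)

  class-candidates : Fin t → List (Fin (n G))
  class-candidates i = map (λ p → neighbour (above i p) i) (allFin (t ∸ toℕ i))

  neighbour-∈-candidates : ∀ {i a} → toℕ i ≤ toℕ a → neighbour a i ∈ class-candidates i
  neighbour-∈-candidates {i} {a} i≤a =
    let (p , above≡a) = above-surjective i a i≤a
    in subst (λ a → neighbour a i ∈ class-candidates i) above≡a (∈-map⁺ _ (∈-allFin p))

  element-∈-candidates : ∀ u → element u ∈ class-candidates (d u)
  element-∈-candidates u =
    let (a , du≤a , eu≡w) = proj₂ (proj₂ (element-candidate u))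
    in subst (_∈ class-candidates (d u)) (≡.sym eu≡w) (neighbour-∈-candidates du≤a)

  class-⊆-candidates : ∀ i →
                       map element (filter (λ u → d u ≟ i) (allFin size)) ⊆ₗ class-candidates i
  class-⊆-candidates i y∈class =
    let (u , u∈filter , y≡eu) = ∈-map⁻ element y∈class
    in subst₂ (λ y i → y ∈ class-candidates i) (≡.sym y≡eu)
              (proj₂ (∈-filter⁻ (λ u → d u ≟ i) {xs = allFin size} u∈filter))
              (element-∈-candidates u)

  class-small : ∀ i → classSize d i ≤ t ∸ toℕ i
  class-small i =
    subst₂ _≤_ (length-map element (filter (λ u → d u ≟ i) (allFin size)))
               (≡.trans (length-map _ (allFin (t ∸ toℕ i))) (length-tabulate _))
      (Unique-⊆⇒length≤
         (Unique.map⁺ injective (Unique.filter⁺ (λ u → d u ≟ i) (Unique.allFin⁺ size)))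
         (class-⊆-candidates i))

  atom-isAtom : PGAtom atom t
  atom-isAtom = d , cv , d-cv , d-proper , class-small , cv-reaches

  atom-isInduced : IsInducedSubgraph atom G
  atom-isInduced = induced-isInduced G injective

module Greedy (G : Graph) where

  Sees : Pred (Fin (n G)) 0ℓ → (Fin (n G) → ℕ) → Fin (n G) → ℕ → Set
  Sees coloured colour v j = ∃ λ w → coloured w × Adj G v w × colour w ≡ j

  record State : Set₁ where
    field
      palette   : ℕ
      coloured  : Pred (Fin (n G)) 0ℓ
      coloured? : Decidable coloured
      colour    : Fin (n G) → ℕ
      proper    : ∀ {u v} → coloured u → coloured v → Adj G u v → colour u ≢ colour v
      bounded   : ∀ {v} → coloured v → colour v < palette
      grundy    : ∀ j → j < palette →
                  ∃ λ v → coloured v × colour v ≡ j × (∀ j′ → j′ < j → Sees coloured colour v j′)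
  open State

  _⊑_ : State → State → Set
  S ⊑ S′ = palette S ≤ palette S′ × coloured S ⊆ coloured S′

  ⊑-refl : ∀ {S} → S ⊑ S
  ⊑-refl = ≤-refl , λ cx → cx

  ⊑-trans : ∀ {S₁ S₂ S₃} → S₁ ⊑ S₂ → S₂ ⊑ S₃ → S₁ ⊑ S₃
  ⊑-trans (p₁₂ , c₁₂) (p₂₃ , c₂₃) = ≤-trans p₁₂ p₂₃ , c₂₃ ∘ c₁₂

  sees? : (S : State) (v : Fin (n G)) → Decidable (Sees (coloured S) (colour S) v)
  sees? S v j = any? λ w → coloured? S w ×-dec (adj G v w Bool.≟ true) ×-dec (colour S w ℕ.≟ j)

  module Colour (S : State) (v : Fin (n G)) (v-new : ¬ coloured S v) (s : ℕ)
                (s-unseen : ¬ Sees (coloured S) (colour S) v s)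
                (below-s-seen : ∀ j → j < s → Sees (coloured S) (colour S) v j) where

    coloured′ : Pred (Fin (n G)) 0ℓ
    coloured′ x = x ≡ v ⊎ coloured S x

    colour′ : Fin (n G) → ℕ
    colour′ = Vector.updateAt (colour S) v (const s)

    colour′-v : colour′ v ≡ s
    colour′-v = updateAt-updates v (colour S)

    colour′-old : ∀ {x} → coloured S x → colour′ x ≡ colour S x
    colour′-old {x} cx = updateAt-minimal x v (colour S) (λ { refl → v-new cx })

    sees′ : ∀ {x j} → Sees (coloured S) (colour S) x j → Sees coloured′ colour′ x j
    sees′ (w , cw , xw , colw≡j) = w , inj₂ cw , xw , ≡.trans (colour′-old cw) colw≡j

    proper′ : ∀ {x y} → coloured′ x → coloured′ y → Adj G x y → colour′ x ≢ colour′ y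
    proper′ (inj₁ refl) (inj₁ refl) vv  _  = Adj-irrefl G vv
    proper′ (inj₁ refl) (inj₂ cy)   vy  eq =
      s-unseen (_ , cy , vy , ≡.trans (≡.sym (colour′-old cy)) (≡.trans (≡.sym eq) colour′-v))
    proper′ (inj₂ cx)   (inj₁ refl) xv  eq =
      s-unseen (_ , cx , Adj-sym G xv , ≡.trans (≡.sym (colour′-old cx)) (≡.trans eq colour′-v))
    proper′ (inj₂ cx)   (inj₂ cy)   xy  eq =
      proper S cx cy xy (≡.trans (≡.sym (colour′-old cx)) (≡.trans eq (colour′-old cy)))

    -- K′ is palette S, or suc (palette S) when s = palette S is a new colour.
    state : (K′ : ℕ) → palette S ≤ K′ → s < K′ → (∀ j → j < K′ → j < palette S ⊎ j ≡ s) → State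
    state K′ P≤K′ s<K′ new-colours = record
      { palette = K′ ; coloured = coloured′
      ; coloured? = λ x → (x ≟ v) ⊎-dec coloured? S x
      ; colour = colour′ ; proper = proper′ ; bounded = bounded′ ; grundy = grundy′ }
      where
      bounded′ : ∀ {x} → coloured′ x → colour′ x < K′
      bounded′ (inj₁ refl) = subst (_< K′) (≡.sym colour′-v) s<K′
      bounded′ (inj₂ cx)   = subst (_< K′) (≡.sym (colour′-old cx)) (<-≤-trans (bounded S cx) P≤K′)
      grundy′ : ∀ j → j < K′ →
                ∃ λ x → coloured′ x × colour′ x ≡ j × (∀ j′ → j′ < j → Sees coloured′ colour′ x j′)
      grundy′ j j<K′ with new-colours j j<K′
      ... | inj₁ j<P with grundy S j j<P
      ...   | x , cx , colx≡j , seen =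
        x , inj₂ cx , ≡.trans (colour′-old cx) colx≡j , λ j′ j′<j → sees′ (seen j′ j′<j)
      grundy′ j j<K′ | inj₂ refl =
        v , inj₁ refl , colour′-v , λ j′ j′<s → sees′ (below-s-seen j′ j′<s)

  extend : (S : State) (v : Fin (n G)) → ∃ λ S′ → S ⊑ S′ × coloured S′ v
  extend S v with coloured? S v
  ... | yes coloured-v = S , ⊑-refl {S} , coloured-v
  ... | no v-new
    with ∃¬-smallest≤ (sees? S v) (palette S)
                      (λ (w , cw , _ , colw≡P) → <-irrefl colw≡P (bounded S cw))
  ...   | s , s≤P , unseen , below-seen with m≤n⇒m<n∨m≡n s≤P
  ...     | inj₁ s<P  =
    state (palette S) ≤-refl s<P (λ j j<P → inj₁ j<P) , (≤-refl , inj₂) , inj₁ refl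
    where open Colour S v v-new s unseen below-seen
  ...     | inj₂ refl =
    state (suc s) (n≤1+n s) ≤-refl (λ j j<1+s → m≤n⇒m<n∨m≡n (≤-pred j<1+s)) ,
    (n≤1+n s , inj₂) , inj₁ refl
    where open Colour S v v-new s unseen below-seen

  colourAll : (xs : List (Fin (n G))) (S : State) →
              ∃ λ S′ → S ⊑ S′ × (∀ {v} → v ∈ xs → coloured S′ v)
  colourAll []       S = S , ⊑-refl {S} , λ ()
  colourAll (x ∷ xs) S with extend S x
  ... | S₁ , S⊑S₁ , cx with colourAll xs S₁
  ...   | S₂ , S₁⊑S₂ , cxs =
    S₂ , ⊑-trans {S} {S₁} {S₂} S⊑S₁ S₁⊑S₂ ,
    λ { (here refl) → proj₂ S₁⊑S₂ cx ; (there v∈xs) → cxs v∈xs }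

  partialGrundyColoring : (S : State) → (∀ v → coloured S v) →
                          HasPartialGrundyColoring G (palette S)
  partialGrundyColoring S all = c , proper′ , surjective , grundy′
    where
    c : Fin (n G) → Fin (palette S)
    c v = fromℕ< (bounded S (all v))
    toℕ-c : ∀ v → toℕ (c v) ≡ colour S v
    toℕ-c v = toℕ-fromℕ< (bounded S (all v))
    proper′ : Proper G (palette S) c
    proper′ u v uv cu≡cv =
      proper S (all u) (all v) uv (≡.trans (≡.sym (toℕ-c u)) (≡.trans (cong toℕ cu≡cv) (toℕ-c v)))
    grundy′ : ∀ i → ∃[ v ] (c v ≡ i × GrundyVertex G (palette S) c v)
    grundy′ i with grundy S (toℕ i) (toℕ<n i)
    ... | v , _ , colv≡i , seen = v , toℕ-injective (≡.trans (toℕ-c v) colv≡i) , grundyVertex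
      where
      grundyVertex : GrundyVertex G (palette S) c v
      grundyVertex j j<cv with seen (toℕ j) (subst (toℕ j <_) (≡.trans (toℕ-c v) colv≡i) j<cv)
      ... | w , _ , vw , colw≡j = w , vw , toℕ-injective (≡.trans (toℕ-c w) colw≡j)
    surjective : ∀ i → ∃ λ v → ∀ {z} → z ≡ v → c z ≡ i
    surjective i with grundy′ i
    ... | v , cv≡i , _ = v , λ { refl → cv≡i }

module FromAtom (G : Graph) {t : ℕ} (A : Graph)
                (d : Fin (n A) → Fin t) (cv : Fin t → Fin (n A))
                (structure : AtomStructure A t d cv)
                (f : Fin (n A) → Fin (n G)) (embedding : InducedEmbedding A G f) where

  open Greedy G

  f-injective : Injective _≡_ _≡_ f
  f-injective = proj₁ embedding

  f-adj : ∀ u v → adj A u v ≡ adj G (f u) (f v)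
  f-adj = proj₂ embedding

  InImage : Pred (Fin (n G)) 0ℓ
  InImage v = ∃ λ a → f a ≡ v

  inImage? : Decidable InImage
  inImage? v = any? λ a → f a ≟ v

  colour : Fin (n G) → ℕ
  colour v with inImage? v
  ... | yes (a , _) = toℕ (d a)
  ... | no _        = 0

  colour-image : ∀ a → colour (f a) ≡ toℕ (d a)
  colour-image a with inImage? (f a)
  ... | yes (a′ , fa′≡fa) = cong (toℕ ∘ d) (f-injective fa′≡fa)
  ... | no outside        = contradiction (a , refl) outside

  proper : ∀ {u v} → InImage u → InImage v → Adj G u v → colour u ≢ colour v
  proper (a , refl) (b , refl) fafb eq =
    proj₁ (proj₂ structure) a b (≡.trans (f-adj a b) fafb)
      (toℕ-injective (≡.trans (≡.sym (colour-image a)) (≡.trans eq (colour-image b))))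

  bounded : ∀ {v} → InImage v → colour v < t
  bounded (a , refl) = subst (_< t) (≡.sym (colour-image a)) (toℕ<n (d a))

  grundy : ∀ j → j < t →
           ∃ λ v → InImage v × colour v ≡ j × (∀ j′ → j′ < j → Sees InImage colour v j′)
  grundy j j<t =
    f (cv i) , (cv i , refl) ,
    ≡.trans (colour-image (cv i)) (≡.trans (cong toℕ (proj₁ structure i)) (toℕ-fromℕ< j<t)) , seen
    where
    i = fromℕ< j<t
    seen : ∀ j′ → j′ < j → Sees InImage colour (f (cv i)) j′
    seen j′ j′<j with proj₂ (proj₂ (proj₂ structure)) i (fromℕ< (<-trans j′<j j<t))
                        (subst₂ _<_ (≡.sym (toℕ-fromℕ< _)) (≡.sym (toℕ-fromℕ< j<t)) j′<j)
    ... | u , cv-u , du≡j′ =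
      f u , (u , refl) , ≡.trans (≡.sym (f-adj (cv i) u)) cv-u ,
      ≡.trans (colour-image u) (≡.trans (cong toℕ du≡j′) (toℕ-fromℕ< _))

  initial : State
  initial = record
    { palette = t ; coloured = InImage ; coloured? = inImage? ; colour = colour
    ; proper = proper ; bounded = bounded ; grundy = grundy }

  partialGrundy : ∃ λ K → t ≤ K × HasPartialGrundyColoring G K
  partialGrundy with colourAll (allFin (n G)) initial
  ... | S , (t≤K , _) , all =
    State.palette S , t≤K , partialGrundyColoring S (λ v → all (∈-allFin v))

mainTheorem1 : (G : Graph) (t : ℕ) → 1 ≤ t → (m : ℕ) → IsPartialGrundyNumber G m →
    (t ≤ m ⇔ (∃[ A ] (MinimalPGAtom A t × IsInducedSubgraph A G)))
mainTheorem1 G t _ m ((c , pgc) , maximal) = mk⇔ atom-from-colouring colouring-from-atom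
  where
  atom-from-colouring : t ≤ m → ∃[ A ] (MinimalPGAtom A t × IsInducedSubgraph A G)
  atom-from-colouring t≤m = minimalAtom-below G atom atom-isAtom atom-isInduced
    where open FromPartialGrundy G t≤m c pgc

  colouring-from-atom : ∃[ A ] (MinimalPGAtom A t × IsInducedSubgraph A G) → t ≤ m
  colouring-from-atom (A , ((d , cv , structure) , _) , (f , embedding)) =
    let (K , t≤K , colouring) = FromAtom.partialGrundy G A d cv structure f embedding
    in ≤-trans t≤K (maximal K colouring)
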